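{- Let $NC$ be an initial neuronal circuit satisfying $\mathit{PositiveLoop}(NC)$, with neurons $N_0,N_1$ (identifiers $0,1$). Assume $w_{N_0}(2)\ge\tau_{N_0}$, $w_{N_0}(1)\ge\tau_{N_0}$ and $w_{N_1}(0)\ge\tau_{N_1}$. Let $\mathit{inp}_1,\mathit{inp}_2$ be lists of booleans, with every entry of $\mathit{inp}_2$ equal to $0$. Then, for the external input sequence $\mathit{inp}_1\mathbin{++}[1;1]\mathbin{++}\mathit{inp}_2$, $$output_{NC}(N_0,\mathit{inp}_1\mathbin{++}[1;1]\mathbin{++}\mathit{inp}_2)=\mathit{repeat}(1,|\mathit{inp}_1|+2)\mathbin{++}\mathit{repeat}(0,|\mathit{inp}_2|+1)$$ and $$output_{NC}(N_1,\mathit{inp}_1\mathbin{++}[1;1]\mathbin{++}\mathit{inp}_2)=\mathit{repeat}(1,|\mathit{inp}_1|+1)\mathbin{++}\mathit{repeat}(0,|\mathit{inp}_2|+2).$$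
   Context: Booleans are identified with $0$ (false) and $1$ (true). A neuron $N$ consists of an identifier $id_N\in\mathbb{N}$, a weight function $w_N:\mathbb{N}\to\mathbb{Q}$ with $-1\le w_N(x)\le 1$ for all $x$ and $w_N(id_N)=0$, a leak factor $lk_N\in\mathbb{Q}$ with $0\le lk_N\le 1$, a threshold $\tau_N\in\mathbb{Q}$ with $\tau_N>0$, an output list $Output(N)$ of booleans (most recent first) and a current potential $CurPot(N)\in\mathbb{Q}$, subject to: $(\tau_N\le CurPot(N))$ equals the head of $Output(N)$ (the head of an empty list being $0$). An input function is a map $i:\mathbb{N}\to\{0,1\}$; $potential(w,i,len)=\sum_{0\le k<len,\ i(k)=1} w(k)$. The one-step update of $N$ with input function $i$ in an environment of $len$ neurons keeps $id,w,lk,\tau$, sets the new potential $p=potential(w_N,i,len)$ if $\tau_N\le CurPot(N)$ and $p=potential(w_N,i,len)+lk_N\cdot CurPot(N)$ otherwise, and sets the new output list to $(\tau_N\le p)::Output(N)$. A neuron is initial if its output list is $[0]$ and its current potential is $0$. A neuronal circuit $NC$ consists of a time $t_{NC}$, a list $ln_{NC}$ of neurons with pairwise distinct identifiers all $<|ln_{NC}|$ and all output lists of length $t_{NC}+1$, and a number $si_{NC}$ of external sources, with identifiers $|ln_{NC}|,\dots,L-1$, $L=|ln_{NC}|+si_{NC}$. One step of $NC$ on an external input function $e$ replaces each neuron $N$ by its one-step update in an environment of $L$ neurons with input function $x\mapsto$ (head of the output list, before the step, of the circuit neuron with identifier $x$ if $x<|ln_{NC}|$; $e(x)$ otherwise),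 and increments the time. A list of external inputs (most recent first, so the last element is the earliest input) is processed from its last element to its first. $output_{NC}(N,\mathit{inp})$ is the output list of the neuron with identifier $id_N$ after processing $\mathit{inp}$. $NC$ is initial if all its neurons are initial. When $si_{NC}=1$, an external input sequence is a list of booleans, each giving the value supplied by the unique external source at that step. $\mathit{PositiveLoop}(NC)$ means: $si_{NC}=1$, $|ln_{NC}|=2$, the neuron with identifier $0$ has $w(1)>0$ and $w(2)>0$, and the neuron with identifier $1$ has $w(0)>0$ and $w(2)=0$ (the external source has identifier $2$). $\mathbin{++}$ is concatenation; $\mathit{repeat}(v,k)$ is the list of $k$ copies of $v$. -}

module Defs where

open import Data.Bool using (Bool; true; false; if_then_else_)
open import Data.Nat as ℕ using (ℕ; zero; suc; _<ᵇ_)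
open import Data.Rational as ℚ using (ℚ; 0ℚ; 1ℚ; -_; _+_; _*_; _≤_; _<_; _≤ᵇ_)
open import Data.List using (List; []; _∷_; length; map)
open import Data.List.Relation.Unary.All using (All)
open import Data.List.Relation.Unary.AllPairs using (AllPairs)
open import Data.Maybe using (Maybe; just; nothing)
open import Data.Product using (_×_)
open import Relation.Binary.PropositionalEquality using (_≡_; _≢_)

headB : List Bool → Bool
headB []      = false
headB (b ∷ _) = b

record Neuron : Set where
  field
    id      : ℕ
    w       : ℕ → ℚ
    w-lo    : ∀ x → - 1ℚ ≤ w x
    w-hi    : ∀ x → w x ≤ 1ℚ
    w-self  : w id ≡ 0ℚ
    lk      : ℚ
    lk-lo   : 0ℚ ≤ lk
    lk-hi   : lk ≤ 1ℚ
    τ       : ℚ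
    τ-pos   : 0ℚ < τ
    Output  : List Bool
    CurPot  : ℚ
    inv     : (τ ≤ᵇ CurPot) ≡ headB Output

open Neuron public

potential : (ℕ → ℚ) → (ℕ → Bool) → ℕ → ℚ
potential w i zero    = 0ℚ
potential w i (suc k) = potential w i k + (if i k then w k else 0ℚ)

nextPot : Neuron → (ℕ → Bool) → ℕ → ℚ
nextPot N i len =
  if τ N ≤ᵇ CurPot N
  then potential (w N) i len
  else potential (w N) i len + lk N * CurPot N

update : Neuron → (ℕ → Bool) → ℕ → Neuron
update N i len = record
  { id = id N ; w = w N ; w-lo = w-lo N ; w-hi = w-hi N ; w-self = w-self N
  ; lk = lk N ; lk-lo = lk-lo N ; lk-hi = lk-hi N ; τ = τ N ; τ-pos = τ-pos N
  ; Output = (τ N ≤ᵇ nextPot N i len) ∷ Output N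
  ; CurPot = nextPot N i len
  ; inv = Relation.Binary.PropositionalEquality.refl }

Initial : Neuron → Set
Initial N = (Output N ≡ false ∷ []) × (CurPot N ≡ 0ℚ)

findNeuron : List Neuron → ℕ → Maybe Neuron
findNeuron []       x = nothing
findNeuron (N ∷ ns) x = if id N ℕ.≡ᵇ x then just N else findNeuron ns x

headOf : Maybe Neuron → Bool
headOf nothing  = false
headOf (just N) = headB (Output N)

record Circuit : Set where
  field
    t       : ℕ
    ln      : List Neuron
    si      : ℕ
    ids-distinct : AllPairs (λ M N → id M ≢ id N) ln
    ids-bound    : All (λ N → id N ℕ.< length ln) ln
    out-length   : All (λ N → length (Output N) ≡ suc t) ln

open Circuit public

InitialCircuit : Circuit → Set
InitialCircuit NC = All Initial (ln NC)

-- input function seen by the neurons at a step: circuit neurons' previous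
-- outputs for identifiers < |ln|, the external input e otherwise
envInput : List Neuron → (ℕ → Bool) → ℕ → Bool
envInput ns e x = if x <ᵇ length ns then headOf (findNeuron ns x) else e x

stepNeurons : ℕ → List Neuron → (ℕ → Bool) → List Neuron
stepNeurons si ns e = map (λ N → update N (envInput ns e) (length ns ℕ.+ si)) ns

-- processing a list of external inputs (most recent first; last element first)
-- with a single external source: each boolean is the value of that source
process : ℕ → List Neuron → List Bool → List Neuron
process si ns []       = ns
process si ns (b ∷ bs) = stepNeurons si (process si ns bs) (λ _ → b)

outputNC : Circuit → ℕ → List Bool → Maybe (List Bool)
outputNC NC x inp = Data.Maybe.map Output (findNeuron (process (si NC) (ln NC) inp) x)

PositiveLoop : Circuit → Set
PositiveLoop NC =
  (si NC ≡ 1) × (length (ln NC) ≡ 2) ×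
  (∀ N → findNeuron (ln NC) 0 ≡ just N → (0ℚ < w N 1) × (0ℚ < w N 2)) ×
  (∀ N → findNeuron (ln NC) 1 ≡ just N → (0ℚ < w N 0) × (w N 2 ≡ 0ℚ))

{-# OPTIONS --safe #-}
module Submission where

-- Along this run every neuron is memoryless: when it stays silent its potential is exactly 0,
-- and when it fires the potential is reset, so the leak never contributes.  The circuit is then
-- the Boolean network (b₀, b₁) ↦ (b₁ ∨ e, b₀) driven by the external input e: N₀ fires iff N₁
-- fired or e = 1 (each weight alone reaches τ₀), and N₁ copies the previous output of N₀.
-- From rest, silent inputs keep both neurons silent, the two 1's switch on N₀ and then N₁,
-- and from then on each neuron keeps the other one firing.

open import Defs
open import Data.Bool using (Bool; true; false; T; _∨_; if_then_else_)
open import Data.Nat using (ℕ; zero; suc; _+_)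
import Data.Nat as ℕ
open import Data.Nat.Properties using (≡ᵇ⇒≡; +-comm)
open import Data.Rational as ℚ using (ℚ; 0ℚ; _≤_; _<_; _≤ᵇ_)
open import Data.Rational.Properties as ℚ
  using (≤-refl; <⇒≤; <-≤-trans; <-irrefl; +-mono-≤; +-identityˡ; +-identityʳ; *-zeroʳ; ≤⇒≤ᵇ; ≤ᵇ⇒≤)
open import Data.List using (List; []; _∷_; _++_; length; replicate; map)
open import Data.List.Properties using (length-map)
open import Data.List.Relation.Unary.All using (All; []; _∷_)
open import Data.Maybe as Maybe using (just)
open import Data.Product using (_×_; _,_; proj₁; proj₂)
open import Data.Empty using (⊥-elim)
open import Relation.Nullary.Decidable using (T?; dec-true; dec-false)
open import Relation.Binary.PropositionalEquality
  using (_≡_; _≗_; refl; sym; trans; cong; cong₂; subst; module ≡-Reasoning)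

gate : Bool → ℚ → ℚ
gate b x = if b then x else 0ℚ

gate-zero : ∀ b → gate b 0ℚ ≡ 0ℚ
gate-zero true  = refl
gate-zero false = refl

gate-nonneg : ∀ {x} → 0ℚ ≤ x → ∀ b → 0ℚ ≤ gate b x
gate-nonneg 0≤x true  = 0≤x
gate-nonneg 0≤x false = ≤-refl

potential-cong : ∀ w {i j} → i ≗ j → ∀ len → potential w i len ≡ potential w j len
potential-cong w i≗j zero    = refl
potential-cong w i≗j (suc k) =
  cong₂ ℚ._+_ (potential-cong w i≗j k) (cong (λ b → gate b (w k)) (i≗j k))

w-self-at : ∀ N {k} → id N ≡ k → w N k ≡ 0ℚ
w-self-at N refl = w-self N

-- A potential that leaves nothing behind: it reaches the threshold (and is reset) or it is 0.
data Response (τ p : ℚ) : Bool → Set where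
  fires : τ ≤ p → Response τ p true
  rests : p ≡ 0ℚ → Response τ p false

response-≤ᵇ : ∀ {τ p b} → 0ℚ < τ → Response τ p b → (τ ≤ᵇ p) ≡ b
response-≤ᵇ _   (fires τ≤p)  = dec-true (T? _) (≤⇒≤ᵇ τ≤p)
response-≤ᵇ 0<τ (rests refl) =
  dec-false (T? _) (λ τ≤0 → <-irrefl refl (<-≤-trans 0<τ (≤ᵇ⇒≤ τ≤0)))

response-silent⇒0 : ∀ {τ p b} → Response τ p b → (τ ≤ᵇ p) ≡ false → p ≡ 0ℚ
response-silent⇒0 (fires τ≤p) silent = ⊥-elim (subst T silent (≤⇒≤ᵇ τ≤p))
response-silent⇒0 (rests p≡0) _      = p≡0

response-gate : ∀ {τ x} → τ ≤ x → ∀ b → Response τ (gate b x) b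
response-gate τ≤x true  = fires τ≤x
response-gate τ≤x false = rests refl

response-∨ : ∀ {τ x y} → 0ℚ < τ → τ ≤ x → τ ≤ y →
  ∀ b c → Response τ (gate b x ℚ.+ gate c y) (b ∨ c)
response-∨ {τ} {x} {y} 0<τ τ≤x τ≤y true c = fires (begin
  τ                ≡⟨ sym (+-identityʳ τ) ⟩
  τ ℚ.+ 0ℚ         ≤⟨ +-mono-≤ τ≤x (gate-nonneg (<⇒≤ (<-≤-trans 0<τ τ≤y)) c) ⟩
  x ℚ.+ gate c y   ∎)
  where open ℚ.≤-Reasoning
response-∨ {τ} {x} {y} _ _ τ≤y false true  = fires (subst (τ ≤_) (sym (+-identityˡ y)) τ≤y)
response-∨             _ _ _   false false = rests refl

Discharged : Neuron → Set
Discharged N = (τ N ≤ᵇ CurPot N) ≡ false → CurPot N ≡ 0ℚ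

nextPot-discharged : ∀ N i len → Discharged N → nextPot N i len ≡ potential (w N) i len
nextPot-discharged N i len = leak-vanishes (τ N ≤ᵇ CurPot N)
  where
  open ≡-Reasoning
  P = potential (w N) i len
  leak-vanishes : ∀ fired → (fired ≡ false → CurPot N ≡ 0ℚ) →
    (if fired then P else P ℚ.+ lk N ℚ.* CurPot N) ≡ P
  leak-vanishes true  _       = refl
  leak-vanishes false at-rest = begin
    P ℚ.+ lk N ℚ.* CurPot N  ≡⟨ cong (λ c → P ℚ.+ lk N ℚ.* c) (at-rest refl) ⟩
    P ℚ.+ lk N ℚ.* 0ℚ        ≡⟨ cong (P ℚ.+_) (*-zeroʳ (lk N)) ⟩
    P ℚ.+ 0ℚ                 ≡⟨ +-identityʳ P ⟩
    P                        ∎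

update-response : ∀ N {i len b} → Discharged N → Response (τ N) (potential (w N) i len) b →
  ((τ N ≤ᵇ nextPot N i len) ≡ b) × Discharged (update N i len)
update-response N {i} {len} {b} discharged response =
  response-≤ᵇ (τ-pos N) response′ , response-silent⇒0 response′
  where
  response′ : Response (τ N) (nextPot N i len) b
  response′ = subst (λ p → Response (τ N) p b) (sym (nextPot-discharged N i len discharged)) response

loopInput : Bool → Bool → Bool → ℕ → Bool
loopInput b₀ b₁ e zero          = b₀
loopInput b₀ b₁ e (suc zero)    = b₁
loopInput b₀ b₁ e (suc (suc _)) = e

potential-loopInput : ∀ w b₀ b₁ e →
  potential w (loopInput b₀ b₁ e) 3 ≡ gate b₀ (w 0) ℚ.+ gate b₁ (w 1) ℚ.+ gate e (w 2)
potential-loopInput w b₀ b₁ e =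
  cong (λ x → x ℚ.+ gate b₁ (w 1) ℚ.+ gate e (w 2)) (+-identityˡ (gate b₀ (w 0)))

Responds : (Bool → Bool → Bool → Bool) → Neuron → Set
Responds f N = ∀ b₀ b₁ e → Response (τ N) (potential (w N) (loopInput b₀ b₁ e) 3) (f b₀ b₁ e)

record Computes (f : Bool → Bool → Bool → Bool) (N : Neuron) (o : List Bool) : Set where
  field
    responds   : Responds f N
    discharged : Discharged N
    output≡    : Output N ≡ o

update-computes : ∀ {f N o i len b₀ b₁ e} →
  Computes f N o → len ≡ 3 → i ≗ loopInput b₀ b₁ e →
  Computes f (update N i len) (f b₀ b₁ e ∷ o)
update-computes {f} {N} {i = i} {b₀ = b₀} {b₁} {e} computes refl i≗loop = record
  { responds   = responds
  ; discharged = proj₂ updated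
  ; output≡    = cong₂ _∷_ (proj₁ updated) output≡
  }
  where
  open Computes computes
  updated = update-response N {i} {3} discharged
    (subst (λ p → Response (τ N) p (f b₀ b₁ e))
      (sym (potential-cong (w N) i≗loop 3)) (responds b₀ b₁ e))

initial-computes : ∀ {f N} → Initial N → Responds f N → Computes f N (false ∷ [])
initial-computes (output≡ , at-rest) responds =
  record { responds = responds ; discharged = λ _ → at-rest ; output≡ = output≡ }

responds-∨ : ∀ N → id N ≡ 0 → τ N ≤ w N 1 → τ N ≤ w N 2 → Responds (λ _ b₁ e → b₁ ∨ e) N
responds-∨ N id≡0 τ≤w₁ τ≤w₂ b₀ b₁ e =
  subst (λ p → Response (τ N) p (b₁ ∨ e)) (sym potential≡)
    (response-∨ (τ-pos N) τ≤w₁ τ≤w₂ b₁ e)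
  where
  open ≡-Reasoning
  potential≡ : potential (w N) (loopInput b₀ b₁ e) 3 ≡ gate b₁ (w N 1) ℚ.+ gate e (w N 2)
  potential≡ = begin
    potential (w N) (loopInput b₀ b₁ e) 3
      ≡⟨ potential-loopInput (w N) b₀ b₁ e ⟩
    gate b₀ (w N 0) ℚ.+ gate b₁ (w N 1) ℚ.+ gate e (w N 2)
      ≡⟨ cong (λ x → gate b₀ x ℚ.+ gate b₁ (w N 1) ℚ.+ gate e (w N 2)) (w-self-at N id≡0) ⟩
    gate b₀ 0ℚ ℚ.+ gate b₁ (w N 1) ℚ.+ gate e (w N 2)
      ≡⟨ cong (λ x → x ℚ.+ gate b₁ (w N 1) ℚ.+ gate e (w N 2)) (gate-zero b₀) ⟩
    0ℚ ℚ.+ gate b₁ (w N 1) ℚ.+ gate e (w N 2)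
      ≡⟨ cong (ℚ._+ gate e (w N 2)) (+-identityˡ (gate b₁ (w N 1))) ⟩
    gate b₁ (w N 1) ℚ.+ gate e (w N 2)
      ∎

responds-copy : ∀ N → id N ≡ 1 → w N 2 ≡ 0ℚ → τ N ≤ w N 0 → Responds (λ b₀ _ _ → b₀) N
responds-copy N id≡1 w₂≡0 τ≤w₀ b₀ b₁ e =
  subst (λ p → Response (τ N) p b₀) (sym potential≡) (response-gate τ≤w₀ b₀)
  where
  open ≡-Reasoning
  potential≡ : potential (w N) (loopInput b₀ b₁ e) 3 ≡ gate b₀ (w N 0)
  potential≡ = begin
    potential (w N) (loopInput b₀ b₁ e) 3
      ≡⟨ potential-loopInput (w N) b₀ b₁ e ⟩
    gate b₀ (w N 0) ℚ.+ gate b₁ (w N 1) ℚ.+ gate e (w N 2)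
      ≡⟨ cong₂ (λ x y → gate b₀ (w N 0) ℚ.+ gate b₁ x ℚ.+ gate e y)
           (w-self-at N id≡1) w₂≡0 ⟩
    gate b₀ (w N 0) ℚ.+ gate b₁ 0ℚ ℚ.+ gate e 0ℚ
      ≡⟨ cong₂ (λ x y → gate b₀ (w N 0) ℚ.+ x ℚ.+ y) (gate-zero b₁) (gate-zero e) ⟩
    gate b₀ (w N 0) ℚ.+ 0ℚ ℚ.+ 0ℚ
      ≡⟨ trans (+-identityʳ _) (+-identityʳ (gate b₀ (w N 0))) ⟩
    gate b₀ (w N 0)
      ∎

findNeuron-map : ∀ (f : Neuron → Neuron) → (∀ N → id (f N) ≡ id N) →
  ∀ ns x → findNeuron (map f ns) x ≡ Maybe.map f (findNeuron ns x)
findNeuron-map f id-f []       x = refl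
findNeuron-map f id-f (N ∷ ns) x rewrite id-f N with id N ℕ.≡ᵇ x
... | true  = refl
... | false = findNeuron-map f id-f ns x

findNeuron-id : ∀ ns {x N} → findNeuron ns x ≡ just N → id N ≡ x
findNeuron-id (M ∷ ns) {x} found with id M ℕ.≡ᵇ x in hit
... | true  with refl ← found = ≡ᵇ⇒≡ (id M) x (subst T (sym hit) _)
... | false = findNeuron-id ns found

findNeuron-All : ∀ {P : Neuron → Set} {ns x N} → All P ns → findNeuron ns x ≡ just N → P N
findNeuron-All {ns = M ∷ ns} {x} (pM ∷ pns) found with id M ℕ.≡ᵇ x
... | true  with refl ← found = pM
... | false = findNeuron-All pns found

envInput-loop : ∀ {ns M₀ M₁} e →
  length ns ≡ 2 → findNeuron ns 0 ≡ just M₀ → findNeuron ns 1 ≡ just M₁ →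
  envInput ns (λ _ → e) ≗ loopInput (headB (Output M₀)) (headB (Output M₁)) e
envInput-loop e two found₀ found₁ zero          rewrite two | found₀ = refl
envInput-loop e two found₀ found₁ (suc zero)    rewrite two | found₁ = refl
envInput-loop e two found₀ found₁ (suc (suc _)) rewrite two = refl

record LoopState (f₀ f₁ : Bool → Bool → Bool → Bool) (ns : List Neuron) (o₀ o₁ : List Bool) : Set
  where
  field
    length≡2  : length ns ≡ 2
    N₀ N₁     : Neuron
    find₀     : findNeuron ns 0 ≡ just N₀
    find₁     : findNeuron ns 1 ≡ just N₁
    computes₀ : Computes f₀ N₀ o₀
    computes₁ : Computes f₁ N₁ o₁

loopState-step : ∀ {f₀ f₁ ns o₀ o₁} → LoopState f₀ f₁ ns o₀ o₁ → ∀ e →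
  LoopState f₀ f₁ (stepNeurons 1 ns (λ _ → e))
    (f₀ (headB o₀) (headB o₁) e ∷ o₀) (f₁ (headB o₀) (headB o₁) e ∷ o₁)
loopState-step {ns = ns} {o₀} {o₁} s e = record
  { length≡2  = trans (length-map step ns) length≡2
  ; find₀     = trans (findNeuron-map step (λ _ → refl) ns 0) (cong (Maybe.map step) find₀)
  ; find₁     = trans (findNeuron-map step (λ _ → refl) ns 1) (cong (Maybe.map step) find₁)
  ; computes₀ = update-computes computes₀ (cong (_+ 1) length≡2) inputs
  ; computes₁ = update-computes computes₁ (cong (_+ 1) length≡2) inputs
  }
  where
  open LoopState s
  step : Neuron → Neuron
  step N = update N (envInput ns (λ _ → e)) (length ns + 1)
  inputs : envInput ns (λ _ → e) ≗ loopInput (headB o₀) (headB o₁) e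
  inputs x = trans (envInput-loop {ns} e length≡2 find₀ find₁ x)
    (cong₂ (λ b₀ b₁ → loopInput b₀ b₁ e x)
      (cong headB (Computes.output≡ computes₀)) (cong headB (Computes.output≡ computes₁)))

loopState-outputs : ∀ {f₀ f₁ ns o₀ o₁} → LoopState f₀ f₁ ns o₀ o₁ →
  (Maybe.map Output (findNeuron ns 0) ≡ just o₀) × (Maybe.map Output (findNeuron ns 1) ≡ just o₁)
loopState-outputs s =
    trans (cong (Maybe.map Output) find₀) (cong just (Computes.output≡ computes₀))
  , trans (cong (Maybe.map Output) find₁) (cong just (Computes.output≡ computes₁))
  where open LoopState s

PositiveLoopState : List Neuron → List Bool → List Bool → Set
PositiveLoopState = LoopState (λ _ b₁ e → b₁ ∨ e) (λ b₀ _ _ → b₀)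

silent-run : ∀ {ns} inp → All (_≡ false) inp → PositiveLoopState ns (false ∷ []) (false ∷ []) →
  PositiveLoopState (process 1 ns inp)
    (replicate (suc (length inp)) false) (replicate (suc (length inp)) false)
silent-run      []            []              s = s
silent-run {ns} (.false ∷ inp) (refl ∷ silent) s =
  loopState-step {ns = process 1 ns inp} (silent-run inp silent s) false

active-run : ∀ {ns o₀ o₁} inp → PositiveLoopState ns (true ∷ o₀) (true ∷ o₁) →
  PositiveLoopState (process 1 ns inp)
    (true ∷ replicate (length inp) true ++ o₀) (true ∷ replicate (length inp) true ++ o₁)
active-run      []        s = s
active-run {ns} (e ∷ inp) s = loopState-step {ns = process 1 ns inp} (active-run inp s) e

process-++ : ∀ si ns xs ys → process si ns (xs ++ ys) ≡ process si (process si ns ys) xs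
process-++ si ns []       ys = refl
process-++ si ns (x ∷ xs) ys =
  cong (λ ns′ → stepNeurons si ns′ (λ _ → x)) (process-++ si ns xs ys)

replicate-++-∷ : ∀ {A : Set} n (x : A) xs → replicate n x ++ x ∷ xs ≡ x ∷ replicate n x ++ xs
replicate-++-∷ zero    x xs = refl
replicate-++-∷ (suc n) x xs = cong (x ∷_) (replicate-++-∷ n x xs)

proposition6p4 : (NC : Circuit) → InitialCircuit NC → PositiveLoop NC →
  (N₀ N₁ : Neuron) → findNeuron (ln NC) 0 ≡ just N₀ → findNeuron (ln NC) 1 ≡ just N₁ →
  τ N₀ ≤ w N₀ 2 → τ N₀ ≤ w N₀ 1 → τ N₁ ≤ w N₁ 0 →
  (inp₁ inp₂ : List Bool) → All (λ b → b ≡ false) inp₂ →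
  (outputNC NC 0 (inp₁ ++ (true ∷ true ∷ []) ++ inp₂)
     ≡ just (replicate (length inp₁ + 2) true ++ replicate (length inp₂ + 1) false))
  × (outputNC NC 1 (inp₁ ++ (true ∷ true ∷ []) ++ inp₂)
     ≡ just (replicate (length inp₁ + 1) true ++ replicate (length inp₂ + 2) false))
proposition6p4 NC initial (si≡1 , two , _ , positive₁) N₀ N₁ found₀ found₁ τ₀≤w₀₂ τ₀≤w₀₁ τ₁≤w₁₀
               inp₁ inp₂ silent
  rewrite si≡1 | process-++ 1 (ln NC) inp₁ (true ∷ true ∷ inp₂)
        | +-comm (length inp₁) 2 | +-comm (length inp₂) 1
        | +-comm (length inp₁) 1 | +-comm (length inp₂) 2 =
    trans (proj₁ outputs) (cong (λ o → just (true ∷ o)) (replicate-++-∷ (length inp₁) true _))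
  , proj₂ outputs
  where
  rest : PositiveLoopState (ln NC) (false ∷ []) (false ∷ [])
  rest = record
    { length≡2  = two ; N₀ = N₀ ; N₁ = N₁ ; find₀ = found₀ ; find₁ = found₁
    ; computes₀ = initial-computes (findNeuron-All initial found₀)
        (responds-∨ N₀ (findNeuron-id (ln NC) found₀) τ₀≤w₀₁ τ₀≤w₀₂)
    ; computes₁ = initial-computes (findNeuron-All initial found₁)
        (responds-copy N₁ (findNeuron-id (ln NC) found₁) (proj₂ (positive₁ N₁ found₁))
          τ₁≤w₁₀)
    }
  outputs = loopState-outputs
    (active-run inp₁ (loopState-step (loopState-step (silent-run inp₂ silent rest) true) true))
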